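{- Let $C$ be an affine configuration, let $d$ be a positive integer, let $k\le k_1\le\dots\le k_d$ be positive integers, and let $F=[k_1]\times\dots\times[k_d]$. Then $$\frac{\mathrm{ex}(F,C)}{k_1\cdots k_d}\le\frac{\mathrm{ex}(k,d,C)}{k^{d}}.$$
   Context: An affine formula is an expression built from variables, the operations $\cap$ and $\cup$, and parentheses (no complements or constants). An affine statement is a statement of the form $f\subset g$ or $f=g$ with $f,g$ affine formulas. An affine configuration $C$ in variables $x_1,\dots,x_k$ is a Boolean expression (using $\land,\lor,\neg$) whose atoms are affine statements. A $d$-dimensional grid is $[k_1]\times\dots\times[k_d]$ with $\subset$ meaning coordinatewise $\le$, $\cap$ the coordinatewise minimum and $\cup$ the coordinatewise maximum. A subset $H$ of a grid contains $C$ if there exist as many distinct elements of $H$ as $C$ has variables which, substituted for the variables, satisfy $C$; otherwise $H$ avoids $C$. $\mathrm{ex}(F,C)$ is the maximum size of a subset of the grid $F$ avoiding $C$, and $\mathrm{ex}(k,d,C)=\mathrm{ex}([k]^d,C)$. -}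

module Defs where

open import Data.Nat using (ℕ; zero; suc; _*_; _≤_; _≤ᵇ_)
open import Data.Bool using (if_then_else_)
open import Data.Fin using (Fin; toℕ) renaming (zero to fz; suc to fs)
open import Data.Product using (Σ; _×_; _,_)
open import Data.Sum using (_⊎_)
open import Data.Empty using (⊥)
open import Data.List using (List; length)
open import Data.List.Relation.Unary.Any using (Any)
open import Data.List.Relation.Unary.AllPairs using (AllPairs)
open import Relation.Binary.PropositionalEquality using (_≡_)
open import Relation.Nullary using (¬_)

data Formula (n : ℕ) : Set where
  var : Fin n → Formula n
  _∩_ : Formula n → Formula n → Formula n
  _∪_ : Formula n → Formula n → Formula n

data AffStmt (n : ℕ) : Set where
  _⊂_ : Formula n → Formula n → AffStmt n
  _≐_ : Formula n → Formula n → AffStmt n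

data Config (n : ℕ) : Set where
  atom : AffStmt n → Config n
  _∧ᶜ_ : Config n → Config n → Config n
  _∨ᶜ_ : Config n → Config n → Config n
  ¬ᶜ_  : Config n → Config n

-- Grid [k_1] × ... × [k_d], sizes given by ks : Fin d → ℕ; coordinate i
-- ranges over Fin (ks i) (a k-element set, order as in ℕ).
Point : {d : ℕ} → (Fin d → ℕ) → Set
Point {d} ks = (i : Fin d) → Fin (ks i)

finMin : {m : ℕ} → Fin m → Fin m → Fin m
finMin a b = if toℕ a ≤ᵇ toℕ b then a else b

finMax : {m : ℕ} → Fin m → Fin m → Fin m
finMax a b = if toℕ a ≤ᵇ toℕ b then b else a

_⊑_ : {d : ℕ} {ks : Fin d → ℕ} → Point ks → Point ks → Set
p ⊑ q = ∀ i → toℕ (p i) ≤ toℕ (q i)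

_≈_ : {d : ℕ} {ks : Fin d → ℕ} → Point ks → Point ks → Set
p ≈ q = ∀ i → p i ≡ q i

meet : {d : ℕ} {ks : Fin d → ℕ} → Point ks → Point ks → Point ks
meet p q i = finMin (p i) (q i)

join : {d : ℕ} {ks : Fin d → ℕ} → Point ks → Point ks → Point ks
join p q i = finMax (p i) (q i)

module _ {d : ℕ} {ks : Fin d → ℕ} where

  evalF : {n : ℕ} → (Fin n → Point ks) → Formula n → Point ks
  evalF σ (var x) = σ x
  evalF σ (f ∩ g) = meet (evalF σ f) (evalF σ g)
  evalF σ (f ∪ g) = join (evalF σ f) (evalF σ g)

  evalS : {n : ℕ} → (Fin n → Point ks) → AffStmt n → Set
  evalS σ (f ⊂ g) = evalF σ f ⊑ evalF σ g
  evalS σ (f ≐ g) = evalF σ f ≈ evalF σ g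

  evalC : {n : ℕ} → (Fin n → Point ks) → Config n → Set
  evalC σ (atom s) = evalS σ s
  evalC σ (c ∧ᶜ c') = evalC σ c × evalC σ c'
  evalC σ (c ∨ᶜ c') = evalC σ c ⊎ evalC σ c'
  evalC σ (¬ᶜ c) = ¬ evalC σ c

  -- A subset of the grid: a duplicate-free list of points.
  IsSubset : List (Point ks) → Set
  IsSubset H = AllPairs (λ p q → ¬ (p ≈ q)) H

  _∈H_ : Point ks → List (Point ks) → Set
  p ∈H H = Any (p ≈_) H

  Contains : {n : ℕ} → List (Point ks) → Config n → Set
  Contains {n} H C = Σ (Fin n → Point ks) λ σ →
    ((x : Fin n) → σ x ∈H H) ×
    ((x y : Fin n) → σ x ≈ σ y → x ≡ y) ×
    evalC σ C

  Avoids : {n : ℕ} → List (Point ks) → Config n → Set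
  Avoids H C = ¬ Contains H C

  IsEx : {n : ℕ} → Config n → ℕ → Set
  IsEx C m =
    (Σ (List (Point ks)) λ H → IsSubset H × Avoids H C × length H ≡ m) ×
    ((H : List (Point ks)) → IsSubset H → Avoids H C → length H ≤ m)

prodF : {d : ℕ} → (Fin d → ℕ) → ℕ
prodF {zero} ks = 1
prodF {suc d} ks = ks fz * prodF (λ i → ks (fs i))

-- The proof is an averaging argument.  Affine configurations are
-- invariant under coordinatewise order embeddings, because such maps
-- commute with coordinatewise min and max and reflect ≤ and =.  Hence if a
-- grid b with b i0 = n > k is given, deleting one value j of coordinate i0
-- embeds the smaller grid (size n − 1 in coordinate i0) into b, and the
-- points of a C-free set H outside the slice {p i0 = j} form a C-free set
-- of the smaller grid.  Every point of H lies outside n − 1 of the n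
-- slices, so summing the bound for the smaller grid over all j gives
--   |H| (n − 1) k^d ≤ n · e′ · |smaller grid| = (n − 1) · e′ · |b|,
-- i.e. the density bound passes from the smaller grid to b.  Shrinking
-- coordinates one step at a time (induction on the grid size) reaches the
-- cube [k]^d, where the bound is the definition of ex(k,d,C).
module Submission where

open import Defs
open import Data.Nat using (ℕ; zero; suc; pred; _+_; _*_; _^_; _≤_; _<_; _≤ᵇ_; _<?_; z≤n; s≤s; >-nonZero)
open import Data.Nat.Properties
  using (_≤?_; module ≤-Reasoning; ≰⇒>; <⇒≤pred; suc-pred; ≤-refl; ≤-trans; ≤-reflexive; ≤-antisym; ≤-pred; <⇒≱; ≮⇒≥; +-mono-≤; *-mono-≤; *-monoˡ-≤; *-monoʳ-<; *-cancelˡ-≤; *-assoc; *-identityʳ; *-zeroʳ; +-0-commutativeMonoid; +-*-semiring)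
open import Data.Fin using (Fin; toℕ; cast; punchIn; punchOut) renaming (_≤_ to _≤ᶠ_; zero to fzero; suc to fsuc)
open import Data.Fin.Properties using (_≟_; toℕ-injective; toℕ-cast; cast-involutive; punchIn-mono-≤; punchIn-cancel-≤; punchIn-punchOut; punchInᵢ≢i; suc-injective; any?)
open import Data.Bool using (if_then_else_)
open import Data.Bool.Properties using (if-float)
open import Data.Product using (_,_)
open import Data.Product.Function.NonDependent.Propositional using (_×-⇔_)
open import Data.Sum.Function.Propositional using (_⊎-⇔_)
open import Data.Unit using (⊤; tt)
open import Data.List using (List; []; _∷_; length; filter)
open import Data.List.Relation.Unary.Any using (here; there)
import Data.List.Relation.Unary.Any.Properties as Any
open import Data.List.Relation.Unary.All using (All; []; _∷_; universal)
import Data.List.Relation.Unary.All.Properties as All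
open import Data.List.Relation.Unary.AllPairs using ([]; _∷_)
import Data.List.Relation.Unary.AllPairs.Properties as AllPairs
open import Function using (_∘_; id; _⇔_; mk⇔; Equivalence)
open import Function.Related.TypeIsomorphisms using (¬-cong-⇔)
open import Relation.Nullary using (¬_; Dec; yes; no; does; ¬?; contradiction)
open import Relation.Nullary.Decidable using (does-⇔; dec-true; dec-false)
open import Relation.Binary.PropositionalEquality
open import Algebra.Properties.CommutativeMonoid.Sum +-0-commutativeMonoid using (sum; sum-cong-≗; ∑-distrib-+; sum-remove)
open import Algebra.Properties.Semiring.Sum +-*-semiring using (*-distribʳ-sum)
open import Data.Nat.Solver using (module +-*-Solver)
open +-*-Solver using (solve; _:*_; _:=_)

record GridEmbedding {d : ℕ} (a b : Fin d → ℕ) : Set where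
  field
    to      : (i : Fin d) → Fin (a i) → Fin (b i)
    mono    : ∀ i {x y : Fin (a i)} → toℕ x ≤ toℕ y → toℕ (to i x) ≤ toℕ (to i y)
    reflect : ∀ i {x y : Fin (a i)} → toℕ (to i x) ≤ toℕ (to i y) → toℕ x ≤ toℕ y

  embed : Point a → Point b
  embed p i = to i (p i)

-- Order embeddings commute with the grid operations, hence preserve and
-- reflect every affine configuration.
module EmbeddingProperties {d : ℕ} {a b : Fin d → ℕ} (E : GridEmbedding a b) where
  open GridEmbedding E

  to-injective : ∀ i {x y : Fin (a i)} → to i x ≡ to i y → x ≡ y
  to-injective i x≡y = toℕ-injective (≤-antisym (reflect i (≤-reflexive (cong toℕ x≡y)))
                                                (reflect i (≤-reflexive (cong toℕ (sym x≡y)))))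

  -- The comparison by which finMin and finMax choose is unchanged by `to i`.
  ≤ᵇ-invariant : ∀ i (x y : Fin (a i)) → (toℕ (to i x) ≤ᵇ toℕ (to i y)) ≡ (toℕ x ≤ᵇ toℕ y)
  ≤ᵇ-invariant i x y = does-⇔ (mk⇔ (reflect i) (mono i)) (toℕ (to i x) ≤? toℕ (to i y)) (toℕ x ≤? toℕ y)

  to-finMin : ∀ i (x y : Fin (a i)) → finMin (to i x) (to i y) ≡ to i (finMin x y)
  to-finMin i x y = trans (cong (λ c → if c then to i x else to i y) (≤ᵇ-invariant i x y))
                          (sym (if-float (to i) (toℕ x ≤ᵇ toℕ y)))

  to-finMax : ∀ i (x y : Fin (a i)) → finMax (to i x) (to i y) ≡ to i (finMax x y)
  to-finMax i x y = trans (cong (λ c → if c then to i y else to i x) (≤ᵇ-invariant i x y))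
                          (sym (if-float (to i) (toℕ x ≤ᵇ toℕ y)))

  evalF-embed : ∀ {n} (σ : Fin n → Point a) (f : Formula n) i → evalF (embed ∘ σ) f i ≡ to i (evalF σ f i)
  evalF-embed σ (var x) i = refl
  evalF-embed σ (f ∩ g) i = trans (cong₂ finMin (evalF-embed σ f i) (evalF-embed σ g i)) (to-finMin i _ _)
  evalF-embed σ (f ∪ g) i = trans (cong₂ finMax (evalF-embed σ f i) (evalF-embed σ g i)) (to-finMax i _ _)

  evalS-embed : ∀ {n} (σ : Fin n → Point a) (s : AffStmt n) → evalS (embed ∘ σ) s ⇔ evalS σ s
  evalS-embed σ (f ⊂ g) = mk⇔
    (λ f⊑g i → reflect i (subst₂ _≤_ (cong toℕ (evalF-embed σ f i)) (cong toℕ (evalF-embed σ g i)) (f⊑g i)))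
    (λ f⊑g i → subst₂ _≤_ (cong toℕ (sym (evalF-embed σ f i))) (cong toℕ (sym (evalF-embed σ g i))) (mono i (f⊑g i)))
  evalS-embed σ (f ≐ g) = mk⇔
    (λ f≈g i → to-injective i (trans (sym (evalF-embed σ f i)) (trans (f≈g i) (evalF-embed σ g i))))
    (λ f≈g i → trans (evalF-embed σ f i) (trans (cong (to i) (f≈g i)) (sym (evalF-embed σ g i))))

  evalC-embed : ∀ {n} (σ : Fin n → Point a) (C : Config n) → evalC (embed ∘ σ) C ⇔ evalC σ C
  evalC-embed σ (atom s)  = evalS-embed σ s
  evalC-embed σ (C ∧ᶜ C′) = evalC-embed σ C ×-⇔ evalC-embed σ C′
  evalC-embed σ (C ∨ᶜ C′) = evalC-embed σ C ⊎-⇔ evalC-embed σ C′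
  evalC-embed σ (¬ᶜ C)    = ¬-cong-⇔ (evalC-embed σ C)

  contains-embed : ∀ {n} (C : Config n) (H′ : List (Point a)) (H : List (Point b)) →
    (∀ p → p ∈H H′ → embed p ∈H H) → Contains H′ C → Contains H C
  contains-embed C H′ H image⊆H (σ , σ∈H′ , σ-injective , σ⊨C) =
    embed ∘ σ , (λ x → image⊆H _ (σ∈H′ x)) ,
    (λ x y σx≈σy → σ-injective x y (λ i → to-injective i (σx≈σy i))) ,
    Equivalence.from (evalC-embed σ C) σ⊨C

-- Restriction along an embedding: if every point of a list L of the big
-- grid satisfying `Good` has a preimage, computed by `lower`, then L is a
-- copy of a list of the small grid of the same length.
module Restriction {d : ℕ} {a b : Fin d → ℕ} (E : GridEmbedding a b)
  (Good : Point b → Set) (lower : (p : Point b) → Good p → Point a)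
  (embed-lower : ∀ p (g : Good p) → GridEmbedding.embed E (lower p g) ≈ p) where
  open GridEmbedding E
  open EmbeddingProperties E

  lowerAll : (L : List (Point b)) → All Good L → List (Point a)
  lowerAll []      []       = []
  lowerAll (p ∷ L) (g ∷ gs) = lower p g ∷ lowerAll L gs

  length-lowerAll : ∀ L gs → length (lowerAll L gs) ≡ length L
  length-lowerAll []      []       = refl
  length-lowerAll (p ∷ L) (g ∷ gs) = cong suc (length-lowerAll L gs)

  lowerAll-∈ : ∀ L gs q → q ∈H lowerAll L gs → embed q ∈H L
  lowerAll-∈ (p ∷ L) (g ∷ gs) q (here q≈) = here (λ i → trans (cong (to i) (q≈ i)) (embed-lower p g i))
  lowerAll-∈ (p ∷ L) (g ∷ gs) q (there q∈) = there (lowerAll-∈ L gs q q∈)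

  lower-injective : ∀ p q (g : Good p) (g′ : Good q) → lower p g ≈ lower q g′ → p ≈ q
  lower-injective p q g g′ lp≈lq i =
    trans (sym (embed-lower p g i)) (trans (cong (to i) (lp≈lq i)) (embed-lower q g′ i))

  lowerAll-distinct : ∀ L gs → IsSubset L → IsSubset (lowerAll L gs)
  lowerAll-distinct []      []       []         = []
  lowerAll-distinct (p ∷ L) (g ∷ gs) (p∉L ∷ ds) = distinct-from L gs p∉L ∷ lowerAll-distinct L gs ds
    where
    distinct-from : ∀ L gs → All (λ q → ¬ p ≈ q) L → All (λ q → ¬ lower p g ≈ q) (lowerAll L gs)
    distinct-from []      []        []          = []
    distinct-from (q ∷ L) (g′ ∷ gs) (p≉q ∷ p∉L) =
      (p≉q ∘ lower-injective p q g g′) ∷ distinct-from L gs p∉L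

  restriction-bound : ∀ {n} (C : Config n) (P : ℕ → Set) →
    ((H′ : List (Point a)) → IsSubset H′ → Avoids H′ C → P (length H′)) →
    (L H : List (Point b)) → All Good L → IsSubset L → (∀ q → q ∈H L → q ∈H H) → Avoids H C →
    P (length L)
  restriction-bound C P bound L H gs distinct L⊆H H-avoids =
    subst P (length-lowerAll L gs)
      (bound (lowerAll L gs) (lowerAll-distinct L gs distinct)
        (H-avoids ∘ contains-embed C (lowerAll L gs) H (λ q q∈ → L⊆H _ (lowerAll-∈ L gs q q∈))))

module Relabel {d : ℕ} {a b : Fin d → ℕ} (a≡b : ∀ i → a i ≡ b i) where

  relabel : GridEmbedding a b
  relabel = record
    { to      = λ i → cast (a≡b i)
    ; mono    = λ i {x} {y} → subst₂ _≤_ (sym (toℕ-cast (a≡b i) x)) (sym (toℕ-cast (a≡b i) y))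
    ; reflect = λ i {x} {y} → subst₂ _≤_ (toℕ-cast (a≡b i) x) (toℕ-cast (a≡b i) y)
    }

  unlabel : Point b → Point a
  unlabel p i = cast (sym (a≡b i)) (p i)

  embed-unlabel : ∀ p → GridEmbedding.embed relabel (unlabel p) ≈ p
  embed-unlabel p i = cast-involutive (a≡b i) (sym (a≡b i)) (p i)

sum-const : ∀ {n} c → sum {n} (λ _ → c) ≡ n * c
sum-const {zero}  c = refl
sum-const {suc n} c = cong (c +_) (sum-const {n} c)

sum-mono : ∀ {n} {f g : Fin n → ℕ} → (∀ j → f j ≤ g j) → sum f ≤ sum g
sum-mono {zero}  f≤g = z≤n
sum-mono {suc n} f≤g = +-mono-≤ (f≤g fzero) (sum-mono (f≤g ∘ fsuc))

miss : ∀ {n} → Fin n → Fin n → ℕ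
miss x j = if does (x ≟ j) then 0 else 1

sum-miss : ∀ {n} (x : Fin n) → sum (miss x) ≡ pred n
sum-miss {suc n} x = begin
  sum (miss x)                                ≡⟨ sum-remove {i = x} (miss x) ⟩
  miss x x + sum (miss x ∘ punchIn x)         ≡⟨ cong₂ _+_ miss-self (sum-cong-≗ miss-others) ⟩
  0 + sum {n} (λ _ → 1)                       ≡⟨ sum-const {n} 1 ⟩
  n * 1                                       ≡⟨ *-identityʳ n ⟩
  n                                           ∎
  where
  open ≡-Reasoning
  miss-self : miss x x ≡ 0
  miss-self rewrite dec-true (x ≟ x) refl = refl
  miss-others : ∀ j → miss x (punchIn x j) ≡ 1
  miss-others j rewrite dec-false (x ≟ punchIn x j) (punchInᵢ≢i x j ∘ sym) = refl

module Slices {d : ℕ} {b : Fin d → ℕ} (i0 : Fin d) where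

  off? : (j : Fin (b i0)) (p : Point b) → Dec (¬ p i0 ≡ j)
  off? j p = ¬? (p i0 ≟ j)

  off : Fin (b i0) → List (Point b) → List (Point b)
  off j = filter (off? j)

  length-off-∷ : ∀ j p H → length (off j (p ∷ H)) ≡ miss (p i0) j + length (off j H)
  length-off-∷ j p H with p i0 ≟ j
  ... | yes _ = refl
  ... | no  _ = refl

  sum-length-off : ∀ H → sum (λ j → length (off j H)) ≡ length H * pred (b i0)
  sum-length-off []      = trans (sum-const {b i0} 0) (*-zeroʳ (b i0))
  sum-length-off (p ∷ H) = begin
    sum (λ j → length (off j (p ∷ H)))                  ≡⟨ sum-cong-≗ (λ j → length-off-∷ j p H) ⟩
    sum (λ j → miss (p i0) j + length (off j H))        ≡⟨ ∑-distrib-+ (miss (p i0)) (λ j → length (off j H)) ⟩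
    sum (miss (p i0)) + sum (λ j → length (off j H))    ≡⟨ cong₂ _+_ (sum-miss (p i0)) (sum-length-off H) ⟩
    pred (b i0) + length H * pred (b i0)                 ∎
    where open ≡-Reasoning

prodF-pos : ∀ {d} (a : Fin d → ℕ) → (∀ i → 0 < a i) → 0 < prodF a
prodF-pos {zero}  a a>0 = s≤s z≤n
prodF-pos {suc d} a a>0 = *-mono-≤ (a>0 fzero) (prodF-pos (a ∘ fsuc) (a>0 ∘ fsuc))

prodF-cong : ∀ {d} {a b : Fin d → ℕ} → (∀ i → a i ≡ b i) → prodF a ≡ prodF b
prodF-cong {zero}  a≡b = refl
prodF-cong {suc d} a≡b = cong₂ _*_ (a≡b fzero) (prodF-cong (a≡b ∘ fsuc))

prodF-const : ∀ {d} (a : Fin d → ℕ) {c : ℕ} → (∀ i → a i ≡ c) → prodF a ≡ c ^ d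
prodF-const {zero}  a a≡c = refl
prodF-const {suc d} a a≡c = cong₂ _*_ (a≡c fzero) (prodF-const (a ∘ fsuc) (a≡c ∘ fsuc))

-- Changing one side length: if a and b agree off i0, then
-- prodF a / a i0 = prodF b / b i0, written without division.
prodF-update : ∀ {d} {a b : Fin d → ℕ} (i0 : Fin d) → (∀ i → ¬ i ≡ i0 → a i ≡ b i) →
  prodF a * b i0 ≡ prodF b * a i0
prodF-update {suc d} {a} {b} fzero a≡b-off = begin
  (a fzero * prodF (a ∘ fsuc)) * b fzero   ≡⟨ cong (λ t → (a fzero * t) * b fzero) (prodF-cong (λ i → a≡b-off (fsuc i) (λ ()))) ⟩
  (a fzero * prodF (b ∘ fsuc)) * b fzero   ≡⟨ solve 3 (λ x p y → (x :* p) :* y := (y :* p) :* x) refl (a fzero) (prodF (b ∘ fsuc)) (b fzero) ⟩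
  (b fzero * prodF (b ∘ fsuc)) * a fzero   ∎
  where open ≡-Reasoning
prodF-update {suc d} {a} {b} (fsuc i0) a≡b-off = begin
  (a fzero * prodF (a ∘ fsuc)) * b (fsuc i0)   ≡⟨ *-assoc (a fzero) _ _ ⟩
  a fzero * (prodF (a ∘ fsuc) * b (fsuc i0))   ≡⟨ cong₂ _*_ (a≡b-off fzero (λ ())) (prodF-update i0 (λ i i≢i0 → a≡b-off (fsuc i) (i≢i0 ∘ suc-injective))) ⟩
  b fzero * (prodF (b ∘ fsuc) * a (fsuc i0))   ≡⟨ *-assoc (b fzero) _ _ ⟨
  (b fzero * prodF (b ∘ fsuc)) * a (fsuc i0)   ∎
  where open ≡-Reasoning

-- Fin (pred n) as Fin n with the value j deleted.
punchIn′ : ∀ {n} → Fin n → Fin (pred n) → Fin n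
punchIn′ {suc n} j = punchIn j

punchOut′ : ∀ {n} {j y : Fin n} → ¬ y ≡ j → Fin (pred n)
punchOut′ {suc n} y≢j = punchOut (y≢j ∘ sym)

punchIn′-punchOut′ : ∀ {n} {j y : Fin n} (y≢j : ¬ y ≡ j) → punchIn′ j (punchOut′ y≢j) ≡ y
punchIn′-punchOut′ {suc n} y≢j = punchIn-punchOut (y≢j ∘ sym)

punchIn′-mono : ∀ {n} (j : Fin n) {x y : Fin (pred n)} → toℕ x ≤ toℕ y → toℕ (punchIn′ j x) ≤ toℕ (punchIn′ j y)
punchIn′-mono {suc n} j = punchIn-mono-≤ j _ _

punchIn′-cancel : ∀ {n} (j : Fin n) {x y : Fin (pred n)} → toℕ (punchIn′ j x) ≤ toℕ (punchIn′ j y) → toℕ x ≤ toℕ y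
punchIn′-cancel {suc n} j = punchIn-cancel-≤ j _ _

-- Sizes and
-- maps are defined by cases on a decision of i ≡ i0, so that in the case
-- i ≡ i0 the sides b i0 and pred (b i0) appear literally.
module Shrink {d : ℕ} (b : Fin d → ℕ) (i0 : Fin d) where

  size : (i : Fin d) → Dec (i ≡ i0) → ℕ
  size i (yes _) = pred (b i)
  size i (no _)  = b i

  shrunk : Fin d → ℕ
  shrunk i = size i (i ≟ i0)

  shrunk-at : shrunk i0 ≡ pred (b i0)
  shrunk-at = at (i0 ≟ i0)
    where
    at : (dec : Dec (i0 ≡ i0)) → size i0 dec ≡ pred (b i0)
    at (yes _)     = refl
    at (no i0≢i0) = contradiction refl i0≢i0

  shrunk-off : ∀ i → ¬ i ≡ i0 → shrunk i ≡ b i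
  shrunk-off i i≢i0 = off (i ≟ i0)
    where
    off : (dec : Dec (i ≡ i0)) → size i dec ≡ b i
    off (yes i≡i0) = contradiction i≡i0 i≢i0
    off (no _)     = refl

  module Delete (j : Fin (b i0)) where

    insert : ∀ i (dec : Dec (i ≡ i0)) → Fin (size i dec) → Fin (b i)
    insert i (yes refl) = punchIn′ j
    insert i (no _)     = id

    insert-mono : ∀ i dec {x y} → toℕ x ≤ toℕ y → toℕ (insert i dec x) ≤ toℕ (insert i dec y)
    insert-mono i (yes refl) = punchIn′-mono j
    insert-mono i (no _)     = id

    insert-cancel : ∀ i dec {x y} → toℕ (insert i dec x) ≤ toℕ (insert i dec y) → toℕ x ≤ toℕ y
    insert-cancel i (yes refl) = punchIn′-cancel j
    insert-cancel i (no _)     = id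

    deletion : GridEmbedding shrunk b
    deletion = record
      { to      = λ i → insert i (i ≟ i0)
      ; mono    = λ i → insert-mono i (i ≟ i0)
      ; reflect = λ i → insert-cancel i (i ≟ i0)
      }

    Hit : ∀ i → Dec (i ≡ i0) → Fin (b i) → Set
    Hit i (yes refl) y = ¬ y ≡ j
    Hit i (no _)     y = ⊤

    remove : ∀ i dec (y : Fin (b i)) → Hit i dec y → Fin (size i dec)
    remove i (yes refl) y y≢j = punchOut′ y≢j
    remove i (no _)     y _   = y

    insert-remove : ∀ i dec y (h : Hit i dec y) → insert i dec (remove i dec y h) ≡ y
    insert-remove i (yes refl) y y≢j = punchIn′-punchOut′ y≢j
    insert-remove i (no _)     y _   = refl

    hit : (p : Point b) → ¬ p i0 ≡ j → ∀ i dec → Hit i dec (p i)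
    hit p p≢j i (yes refl) = p≢j
    hit p p≢j i (no _)     = tt

    lower : (p : Point b) → ¬ p i0 ≡ j → Point shrunk
    lower p p≢j i = remove i (i ≟ i0) (p i) (hit p p≢j i (i ≟ i0))

    embed-lower : ∀ p (p≢j : ¬ p i0 ≡ j) → GridEmbedding.embed deletion (lower p p≢j) ≈ p
    embed-lower p p≢j i = insert-remove i (i ≟ i0) (p i) (hit p p≢j i (i ≟ i0))

  prodF-shrunk : prodF shrunk * b i0 ≡ prodF b * pred (b i0)
  prodF-shrunk = trans (prodF-update i0 shrunk-off) (cong (prodF b *_) shrunk-at)

  shrunk-≥ : ∀ {k} → k ≤ pred (b i0) → (∀ i → k ≤ b i) → ∀ i → k ≤ shrunk i
  shrunk-≥ {k} k≤pred k≤b i = bound (i ≟ i0)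
    where
    bound : (dec : Dec (i ≡ i0)) → k ≤ size i dec
    bound (yes refl) = k≤pred
    bound (no _)     = k≤b i

shrunk-smaller : ∀ {P′ P n} → P′ * n ≡ P * pred n → 0 < P′ → 0 < n → P′ < P
shrunk-smaller {P′} {P} {n} P′n≡Pn-1 P′>0 n>0 = ≰⇒> (λ P≤P′ → <⇒≱ P′n-1<P′n (begin
  P′ * n       ≡⟨ P′n≡Pn-1 ⟩
  P * pred n   ≤⟨ *-monoˡ-≤ (pred n) P≤P′ ⟩
  P′ * pred n  ∎))
  where
  open ≤-Reasoning
  P′n-1<P′n : P′ * pred n < P′ * n
  P′n-1<P′n = *-monoʳ-< P′ {{>-nonZero P′>0}} (≤-reflexive (suc-pred n {{>-nonZero n>0}}))

cancel-average : ∀ {L K E P′ P n} → 0 < pred n → P′ * n ≡ P * pred n →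
  (L * pred n) * K ≤ n * (E * P′) → L * K ≤ E * P
cancel-average {L} {K} {E} {P′} {P} {n} n-1>0 P′n≡Pn-1 summed =
  *-cancelˡ-≤ (pred n) {{>-nonZero n-1>0}} (begin
    pred n * (L * K)   ≡⟨ solve 3 (λ m l k → m :* (l :* k) := (l :* m) :* k) refl (pred n) L K ⟩
    (L * pred n) * K   ≤⟨ summed ⟩
    n * (E * P′)       ≡⟨ solve 3 (λ n e p → n :* (e :* p) := e :* (p :* n)) refl n E P′ ⟩
    E * (P′ * n)       ≡⟨ cong (E *_) P′n≡Pn-1 ⟩
    E * (P * pred n)   ≡⟨ solve 3 (λ e p m → e :* (p :* m) := m :* (e :* p)) refl E P (pred n) ⟩
    pred n * (E * P)   ∎)
  where open ≤-Reasoning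

module DensityInduction {n : ℕ} (C : Config n) {d : ℕ} (k e′ : ℕ) (k>0 : 0 < k)
  (cube-bound : (H : List (Point {d} (λ _ → k))) → IsSubset H → Avoids H C → length H ≤ e′) where

  DensityBound : (Fin d → ℕ) → Set
  DensityBound ks = (H : List (Point ks)) → IsSubset H → Avoids H C → length H * k ^ d ≤ e′ * prodF ks

  cube-density : (ks : Fin d → ℕ) → (∀ i → ks i ≡ k) → DensityBound ks
  cube-density ks ks≡k H distinct avoids = begin
    length H * k ^ d  ≤⟨ *-monoˡ-≤ (k ^ d) |H|≤e′ ⟩
    e′ * k ^ d        ≡⟨ cong (e′ *_) (prodF-const ks ks≡k) ⟨
    e′ * prodF ks     ∎
    where
    open ≤-Reasoning
    open Relabel {a = λ _ → k} {b = ks} (sym ∘ ks≡k)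
    open Restriction relabel (λ _ → ⊤) (λ p _ → unlabel p) (λ p _ → embed-unlabel p)
    |H|≤e′ : length H ≤ e′
    |H|≤e′ = restriction-bound C (_≤ e′) cube-bound H H (universal (λ _ → tt) H) distinct (λ _ → id) avoids

  shrink-step : (ks : Fin d → ℕ) (i0 : Fin d) → 0 < pred (ks i0) →
    DensityBound (Shrink.shrunk ks i0) → DensityBound ks
  shrink-step ks i0 ks₀-1>0 shrunk-bound H distinct avoids =
    cancel-average {length H} {K} {e′} {P′} {prodF ks} {ks i0} ks₀-1>0 prodF-shrunk summed
    where
    open Shrink ks i0
    open Slices {b = ks} i0
    K = k ^ d
    P′ = prodF shrunk

    -- The points of H off the slice {p i0 = j} form a C-free set of the
    -- shrunk grid.
    off-bound : ∀ j → length (off j H) * K ≤ e′ * P′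
    off-bound j = restriction-bound C (λ l → l * K ≤ e′ * P′) shrunk-bound (off j H) H
      (All.all-filter (off? j) H) (AllPairs.filter⁺ (off? j) distinct) (λ _ → Any.filter⁻ (off? j)) avoids
      where
      open Delete j
      open Restriction deletion (λ p → ¬ p i0 ≡ j) lower embed-lower

    -- Summing over the b i0 slices; each point of H is counted b i0 − 1 times.
    summed : (length H * pred (ks i0)) * K ≤ ks i0 * (e′ * P′)
    summed = begin
      (length H * pred (ks i0)) * K        ≡⟨ cong (_* K) (sum-length-off H) ⟨
      sum (λ j → length (off j H)) * K     ≡⟨ *-distribʳ-sum K (λ j → length (off j H)) ⟩
      sum (λ j → length (off j H) * K)     ≤⟨ sum-mono off-bound ⟩
      sum {ks i0} (λ _ → e′ * P′)          ≡⟨ sum-const {ks i0} (e′ * P′) ⟩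
      ks i0 * (e′ * P′)                    ∎
      where open ≤-Reasoning

  -- Induction on (an upper bound N for) the size of the grid: shrink a
  -- side exceeding k, or, if none does, the grid is the cube.
  density-bound : (N : ℕ) (ks : Fin d → ℕ) → (∀ i → k ≤ ks i) → prodF ks ≤ N → DensityBound ks
  density-bound zero ks k≤ks P≤0 = contradiction P≤0 (<⇒≱ (prodF-pos ks (λ i → ≤-trans k>0 (k≤ks i))))
  density-bound (suc N) ks k≤ks P≤N with any? (λ i → k <? ks i)
  ... | no  no-long-side = cube-density ks (λ i → ≤-antisym (≮⇒≥ (λ k<ks → no-long-side (i , k<ks))) (k≤ks i))
  ... | yes (i0 , k<ks₀) =
    shrink-step ks i0 (≤-trans k>0 k≤ks₀-1) (density-bound N shrunk k≤shrunk (≤-pred (≤-trans shrunk<ks P≤N)))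
    where
    open Shrink ks i0
    k≤ks₀-1 : k ≤ pred (ks i0)
    k≤ks₀-1 = <⇒≤pred k<ks₀
    k≤shrunk : ∀ i → k ≤ shrunk i
    k≤shrunk = shrunk-≥ k≤ks₀-1 k≤ks
    shrunk<ks : prodF shrunk < prodF ks
    shrunk<ks = shrunk-smaller prodF-shrunk (prodF-pos shrunk (λ i → ≤-trans k>0 (k≤shrunk i))) (≤-trans k>0 (k≤ks i0))

-- A maximum C-free set H of the grid ks has e points; apply the density
-- bound to it.
claim3p2 : {n : ℕ} (C : Config n) (d : ℕ) → 0 < d →
    (k : ℕ) (ks : Fin d → ℕ) → 0 < k →
    (∀ i → k ≤ ks i) → (∀ i j → i ≤ᶠ j → ks i ≤ ks j) →
    (e e′ : ℕ) → IsEx {d} {ks} C e → IsEx {d} {λ _ → k} C e′ →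
    e * k ^ d ≤ e′ * prodF ks
claim3p2 C d _ k ks k>0 k≤ks _ e e′ ((H , distinct , avoids , |H|≡e) , _) (_ , cube-bound) =
  subst (λ t → t * k ^ d ≤ e′ * prodF ks) |H|≡e
    (density-bound (prodF ks) ks k≤ks ≤-refl H distinct avoids)
  where open DensityInduction C k e′ k>0 cube-bound
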